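{- Let $G_1$ and $G_2$ be graphs admitting identical biarithmetic integer additive set-indexers. Then the corona $G_1\circ G_2$ does not admit an identical biarithmetic integer additive set-indexer.
   Context: All graphs are simple, finite, with no isolated vertices; all sets are finite sets of non-negative integers. For sets $A,B$, $A+B=\{a+b: a\in A, b\in B\}$. An integer additive set-indexer (IASI) of a graph $G$ is an injective function $f:V(G)\to 2^{\mathbb{N}_0}$ such that the induced function $g_f(uv)=f(u)+f(v)$ on $E(G)$ is also injective. An AP-set is a set whose elements form an arithmetic progression; the common difference of the set-label of an element is its deterministic index. An arithmetic IASI is an IASI under which all vertex and edge set-labels are AP-sets. An arithmetic IASI is identical biarithmetic if there is a single positive integer $k$ such that for every pair of adjacent vertices, the deterministic index of one equals $k$ times that of the other. The corona $G_1\circ G_2$ is obtained by taking one copy of $G_1$ (with $p_1$ vertices) and $p_1$ copies of $G_2$, and joining the $i$-th vertex of $G_1$ to every vertex of the $i$-th copy of $G_2$. -}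

module Defs where

open import Data.Nat using (ℕ; zero; suc; _+_; _*_; _≤_; _<_)
open import Data.Fin using (Fin; splitAt; remQuot)
open import Data.List using (List)
open import Data.List.Membership.Propositional using (_∈_)
open import Data.Product using (Σ; ∃; ∃-syntax; _×_; _,_)
open import Data.Sum using (_⊎_; inj₁; inj₂)
open import Data.Empty using (⊥)
open import Relation.Nullary using (¬_)
open import Relation.Binary.PropositionalEquality using (_≡_)
open import Function.Bundles using (_⇔_)

-- Finite sets of non-negative integers, represented by lists (duplicates and
-- order are irrelevant: sets are compared extensionally via membership).
FinSet : Set
FinSet = List ℕ

_≈ₛ_ : FinSet → FinSet → Set
A ≈ₛ B = ∀ x → (x ∈ A) ⇔ (x ∈ B)

_∈Sum_,_ : ℕ → FinSet → FinSet → Set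
x ∈Sum A , B = ∃[ a ] ∃[ b ] (a ∈ A × b ∈ B × x ≡ a + b)

SumEq : FinSet → FinSet → FinSet → FinSet → Set
SumEq A B C D = ∀ x → (x ∈Sum A , B) ⇔ (x ∈Sum C , D)

-- A set given by a membership predicate is the AP-set
-- {a, a+d, ..., a+(m-1)d} with m ≥ 2 elements and common difference d ≥ 1.
-- (So d is the deterministic index of the set.)
IsAPWith : (ℕ → Set) → ℕ → Set
IsAPWith P d = 1 ≤ d × ∃[ a ] ∃[ m ] (2 ≤ m × (∀ x → P x ⇔ (∃[ i ] (i < m × x ≡ a + i * d))))

APDet : FinSet → ℕ → Set
APDet A d = IsAPWith (λ x → x ∈ A) d

SumIsAP : FinSet → FinSet → Set
SumIsAP A B = ∃[ d ] IsAPWith (λ x → x ∈Sum A , B) d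

Rel : ℕ → Set₁
Rel n = Fin n → Fin n → Set

IsIASI : (n : ℕ) → Rel n → (Fin n → FinSet) → Set
IsIASI n Adj f =
  (∀ u v → f u ≈ₛ f v → u ≡ v) ×
  -- induced edge function g_f(uv) = f(u) + f(v) injective on (unordered) edges
  (∀ u v x y → Adj u v → Adj x y → SumEq (f u) (f v) (f x) (f y) →
     (u ≡ x × v ≡ y) ⊎ (u ≡ y × v ≡ x))

IsIdBiarithIASI : (n : ℕ) → Rel n → (Fin n → FinSet) → Set
IsIdBiarithIASI n Adj f =
  IsIASI n Adj f ×
  (∀ u v → Adj u v → SumIsAP (f u) (f v)) ×
  Σ (Fin n → ℕ) λ d →
    (∀ v → APDet (f v) (d v)) ×
    ∃[ k ] (2 ≤ k × (∀ u v → Adj u v → d u ≡ k * d v ⊎ d v ≡ k * d u))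

AdmitsIdBiarithIASI : (n : ℕ) → Rel n → Set
AdmitsIdBiarithIASI n Adj = ∃[ f ] IsIdBiarithIASI n Adj f

record Graph : Set₁ where
  field
    n          : ℕ
    Adj        : Rel n
    sym        : ∀ {u v} → Adj u v → Adj v u
    irrefl     : ∀ {v} → ¬ Adj v v
    nonempty   : 1 ≤ n
    noIsolated : ∀ v → ∃[ u ] Adj v u

-- Vertices of the corona: Fin p₁ ⊎ (Fin p₁ × Fin p₂)
-- (inj₁ i = i-th vertex of G₁; inj₂ (i , w) = vertex w of the i-th copy of G₂).
CoronaAdj' : (G₁ G₂ : Graph) →
  (Fin (Graph.n G₁) ⊎ (Fin (Graph.n G₁) × Fin (Graph.n G₂))) →
  (Fin (Graph.n G₁) ⊎ (Fin (Graph.n G₁) × Fin (Graph.n G₂))) → Set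
CoronaAdj' G₁ G₂ (inj₁ i) (inj₁ j) = Graph.Adj G₁ i j
CoronaAdj' G₁ G₂ (inj₁ i) (inj₂ (j , w)) = i ≡ j
CoronaAdj' G₁ G₂ (inj₂ (j , w)) (inj₁ i) = i ≡ j
CoronaAdj' G₁ G₂ (inj₂ (i , v)) (inj₂ (j , w)) = i ≡ j × Graph.Adj G₂ v w

coronaSize : Graph → Graph → ℕ
coronaSize G₁ G₂ = Graph.n G₁ + Graph.n G₁ * Graph.n G₂

coronaView : (G₁ G₂ : Graph) → Fin (coronaSize G₁ G₂) →
  Fin (Graph.n G₁) ⊎ (Fin (Graph.n G₁) × Fin (Graph.n G₂))
coronaView G₁ G₂ x with splitAt (Graph.n G₁) x
... | inj₁ i = inj₁ i
... | inj₂ y = inj₂ (remQuot (Graph.n G₂) y)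

CoronaAdj : (G₁ G₂ : Graph) → Rel (coronaSize G₁ G₂)
CoronaAdj G₁ G₂ x y = CoronaAdj' G₁ G₂ (coronaView G₁ G₂ x) (coronaView G₁ G₂ y)

module Submission where

-- In an identical biarithmetic IASI with ratio k ≥ 2, the
-- (positive) deterministic indices of any two adjacent vertices are
-- "k-related": one is k times the other.  No three positive numbers can be
-- pairwise k-related: orient each related pair from the smaller to the larger
-- number.  If two of the three orientations meet head-to-head or tail-to-tail
-- at some number, cancelling k shows that the other two numbers coincide, yet
-- they are k-related, which is impossible for a positive number; otherwise the
-- orientations form a directed cycle of strict inequalities.  Hence a graph
-- containing a triangle admits no identical biarithmetic IASI.  The corona
-- G₁ ∘ G₂ always contains a triangle: a vertex i of G₁ together with an edge
-- of the i-th copy of G₂ (which exists since G₂ is nonempty and has no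
-- isolated vertices).

open import Defs
open import Relation.Nullary using (¬_)
open import Data.Empty using (⊥)
open import Data.Nat using (ℕ; suc; _*_; _≤_; _<_)
open import Data.Nat.Base using (>-nonZero)
open import Data.Nat.Properties using (*-comm; *-cancelˡ-≡; m<m*n; <-irrefl; <-trans; <⇒≤)
open import Data.Fin using (Fin; _↑ˡ_; _↑ʳ_; combine; fromℕ<)
open import Data.Fin.Properties using (splitAt-↑ˡ; splitAt-↑ʳ; remQuot-combine)
open import Data.Product using (∃-syntax; _×_; _,_)
open import Data.Sum using (_⊎_; inj₁; inj₂)
open import Relation.Binary.PropositionalEquality using (_≡_; refl; sym; trans; subst)

Related : ℕ → ℕ → ℕ → Set
Related k x y = x ≡ k * y ⊎ y ≡ k * x

module KRelated {k : ℕ} (2≤k : 2 ≤ k) where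

  below : ∀ {x y} → 1 ≤ y → x ≡ k * y → y < x
  below {y = suc y} _ refl = subst (suc y <_) (*-comm (suc y) k) (m<m*n (suc y) k 2≤k)

  cancel : ∀ {x y} → k * x ≡ k * y → x ≡ y
  cancel {x} {y} = *-cancelˡ-≡ x y k {{>-nonZero (<⇒≤ 2≤k)}}

  not-self-related : ∀ {x} → 1 ≤ x → ¬ Related k x x
  not-self-related 1≤x (inj₁ x≡kx) = <-irrefl refl (below 1≤x x≡kx)
  not-self-related 1≤x (inj₂ x≡kx) = <-irrefl refl (below 1≤x x≡kx)

  related-distinct : ∀ {x y} → 1 ≤ y → x ≡ y → ¬ Related k x y
  related-distinct 1≤y refl = not-self-related 1≤y

  same-multiple : ∀ {x y z} → x ≡ k * y → x ≡ k * z → y ≡ z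
  same-multiple x≡ky x≡kz = cancel (trans (sym x≡ky) x≡kz)

  same-factor : ∀ {x y z} → y ≡ k * x → z ≡ k * x → y ≡ z
  same-factor y≡kx z≡kx = trans y≡kx (sym z≡kx)

  no-scaling-cycle : ∀ {a b c} → 1 ≤ a → 1 ≤ b → 1 ≤ c →
    a ≡ k * b → b ≡ k * c → c ≡ k * a → ⊥
  no-scaling-cycle 1≤a 1≤b 1≤c a≡kb b≡kc c≡ka =
    <-irrefl refl (<-trans (below 1≤a c≡ka) (<-trans (below 1≤c b≡kc) (below 1≤b a≡kb)))

  no-related-triangle : ∀ {a b c} → 1 ≤ a → 1 ≤ b → 1 ≤ c →
    Related k a b → Related k b c → Related k c a → ⊥
  no-related-triangle 1≤a 1≤b 1≤c (inj₁ a≡kb) (inj₁ b≡kc) (inj₁ c≡ka) =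
    no-scaling-cycle 1≤a 1≤b 1≤c a≡kb b≡kc c≡ka
  no-related-triangle _ _ 1≤c (inj₁ a≡kb) bc (inj₂ a≡kc) =
    related-distinct 1≤c (same-multiple a≡kb a≡kc) bc
  no-related-triangle 1≤a _ _ (inj₁ a≡kb) (inj₂ c≡kb) ca =
    related-distinct 1≤a (sym (same-factor a≡kb c≡kb)) ca
  no-related-triangle 1≤a _ _ (inj₂ b≡ka) (inj₁ b≡kc) ca =
    related-distinct 1≤a (sym (same-multiple b≡ka b≡kc)) ca
  no-related-triangle _ _ 1≤c (inj₂ b≡ka) bc (inj₁ c≡ka) =
    related-distinct 1≤c (same-factor b≡ka c≡ka) bc
  no-related-triangle 1≤a 1≤b 1≤c (inj₂ b≡ka) (inj₂ c≡kb) (inj₂ a≡kc) =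
    no-scaling-cycle 1≤c 1≤b 1≤a c≡kb b≡ka a≡kc

HasTriangle : (n : ℕ) → Rel n → Set
HasTriangle n Adj = ∃[ x ] ∃[ y ] ∃[ z ] (Adj x y × Adj y z × Adj z x)

-- A graph containing a triangle admits no identical biarithmetic IASI: the
-- deterministic indices (positive, as AP-sets have d ≥ 1) of its corners
-- would be pairwise k-related.
triangle-obstructs : (n : ℕ) (Adj : Rel n) →
  HasTriangle n Adj → ¬ AdmitsIdBiarithIASI n Adj
triangle-obstructs n Adj (x , y , z , xy , yz , zx) (f , _ , _ , d , ap , k , 2≤k , related) =
  KRelated.no-related-triangle 2≤k (positive x) (positive y) (positive z)
    (related x y xy) (related y z yz) (related z x zx)
  where
    positive : ∀ v → 1 ≤ d v
    positive v with ap v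
    ... | 1≤d , _ = 1≤d

module CoronaVertices (G₁ G₂ : Graph) where
  open Graph

  base : Fin (n G₁) → Fin (coronaSize G₁ G₂)
  base i = i ↑ˡ (n G₁ * n G₂)

  copy : Fin (n G₁) → Fin (n G₂) → Fin (coronaSize G₁ G₂)
  copy i v = n G₁ ↑ʳ combine i v

  base-view : ∀ i → coronaView G₁ G₂ (base i) ≡ inj₁ i
  base-view i rewrite splitAt-↑ˡ (n G₁) i (n G₁ * n G₂) = refl

  copy-view : ∀ i v → coronaView G₁ G₂ (copy i v) ≡ inj₂ (i , v)
  copy-view i v rewrite splitAt-↑ʳ (n G₁) (n G₁ * n G₂) (combine i v)
                      | remQuot-combine {n G₁} {n G₂} i v = refl

  cone-triangle : ∀ i v w → Adj G₂ v w →
    HasTriangle (coronaSize G₁ G₂) (CoronaAdj G₁ G₂)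
  cone-triangle i v w vw = base i , copy i v , copy i w , base-copy , copy-copy , copy-base
    where
      base-copy : CoronaAdj G₁ G₂ (base i) (copy i v)
      base-copy rewrite base-view i | copy-view i v = refl
      copy-copy : CoronaAdj G₁ G₂ (copy i v) (copy i w)
      copy-copy rewrite copy-view i v | copy-view i w = refl , vw
      copy-base : CoronaAdj G₁ G₂ (copy i w) (base i)
      copy-base rewrite base-view i | copy-view i w = refl

  corona-has-triangle : HasTriangle (coronaSize G₁ G₂) (CoronaAdj G₁ G₂)
  corona-has-triangle with noIsolated G₂ (fromℕ< (nonempty G₂))
  ... | w , vw = cone-triangle (fromℕ< (nonempty G₁)) (fromℕ< (nonempty G₂)) w vw

proposition2p16 : (G₁ G₂ : Graph) →
    AdmitsIdBiarithIASI (Graph.n G₁) (Graph.Adj G₁) →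
    AdmitsIdBiarithIASI (Graph.n G₂) (Graph.Adj G₂) →
    ¬ AdmitsIdBiarithIASI (coronaSize G₁ G₂) (CoronaAdj G₁ G₂)
proposition2p16 G₁ G₂ _ _ =
  triangle-obstructs (coronaSize G₁ G₂) (CoronaAdj G₁ G₂)
    (CoronaVertices.corona-has-triangle G₁ G₂)
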